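{- For every integer $n\ge 1$ and every integer $i\ge 0$ the following holds. Let $k=\ell(n)+1$, where $\ell(n)$ is the length of $b(n)$, and let $G$ be the Dyck nest of length $2k$ obtained from $F(\rho(n))$ by repeated blowing. Then applying the castling operation with parameter $\gamma(n)$ to the Dyck nest $q^i(G)$ (of length $2(k+i)$) yields $q^i(F(n))$; that is, castling commutes with blowing: $\mathrm{Cast}_{\gamma(n)}(q^i(G))=q^i(\mathrm{Cast}_{\gamma(n)}(G))$.
   Context: Dyck words and Dyck nests. A Dyck word of length $2k$ is a binary string with $k$ ones in which every prefix has at least as many 0s as 1s. Reading it left to right, 0 = up-step and 1 = down-step gives a lattice path from height 0. Its Dyck nest is the integer string obtained by labelling the steps with $1,2,\ldots,k$: process the horizontal unit layers $[y,y+1]$, $y=0,1,2,\dots$, in increasing order, and in each layer assign consecutive integers (continuing the count) to the up-steps from right to left and likewise to the down-steps from right to left. In a Dyck nest of length $2k$ the two entries equal to $k$ are adjacent. Blowing. For a Dyck nest $H$ of length $2K$, $q(H)$ is the string of length $2K+2$ obtained by inserting $(K+1)(K+1)$ between the two adjacent entries of $H$ equal to $K$; $q^i$ denotes $i$-fold iteration. Repeated blowing of a Dyck nest of length $2K\le 2k$ to length $2k$ means applying $q^{k-K}$. Tight restricted-growth strings (TRGS). A TRGS is a string $a_{L}a_{L-1}\cdots a_1$ of nonnegative integers (positions counted from the right) such that either $L=1$ and $a_1\in\{0,1\}$, or $L\ge 2$, $a_L=1$ and $a_j\le a_{j+1}+1$ for $1\le j<L$. Order the TRGSs first by length and, within a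 given length, lexicographically; let $b(0)=0,b(1)=1,b(2)=10,b(3)=11,b(4)=12,b(5)=100,\ldots$ be the resulting enumeration. For $n\ge1$, $\gamma(n)$ is the position (counted from the right, rightmost position $=1$) of the rightmost nonzero entry of $b(n)$. The parent $\rho(n)$ of $n\ge 1$ is defined by: if $\gamma(n)$ equals the length of $b(n)$ then $\rho(n)=0$; otherwise $b(\rho(n))$ is obtained from $b(n)$ by decreasing its entry at position $\gamma(n)$ by $1$. Castling. For a Dyck nest $H$ of length $2K$ and an integer $\gamma\ge1$, write $H=W\,M\,Z$ with $|W|=\gamma-1$ and $|Z|=\gamma$; let $x$ be the first entry of $M$, and split $M=X\,Y$ where $Y$ begins at the first entry of $M$ after its first entry that is equal to $x+1$. Then $\mathrm{Cast}_\gamma(H)=W\,Y\,X\,Z$. The nests $F(n)$. Set $F(0)=11$. For $n\ge1$, with $k=\ell(n)+1$ and $G$ the blow of $F(\rho(n))$ to length $2k$, set $F(n)=\mathrm{Cast}_{\gamma(n)}(G)$. (E.g. $F(1)=2211$, $F(2)=133221$, $F(3)=221331$, $F(4)=332211$.) -}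

module Defs where

open import Data.Nat using (ℕ; zero; suc; _+_; _∸_; _≟_; _≡ᵇ_; _/_)
open import Data.Bool using (Bool; true; false; if_then_else_)
open import Data.List using (List; []; _∷_; _++_; length; reverse; concatMap; take; drop; upTo; map)
open import Data.List.Properties using (≡-dec)
open import Relation.Nullary using (does)
open import Data.Product using (_×_; _,_; proj₁; proj₂)

-- Strings are lists of naturals, written left to right.

-- all strings c_1 ... c_m (left to right) with c_1 ≤ p+1 and
-- c_{j+1} ≤ c_j + 1, in lexicographic order
ext : ℕ → ℕ → List (List ℕ)
ext p zero = [] ∷ []
ext p (suc m) = concatMap (λ c → map (c ∷_) (ext c m)) (upTo (suc (suc p)))

trgsOfLength : ℕ → List (List ℕ)
trgsOfLength zero = []
trgsOfLength (suc zero) = (0 ∷ []) ∷ (1 ∷ []) ∷ []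
trgsOfLength (suc (suc m)) = map (1 ∷_) (ext 1 (suc m))

trgsUpTo : ℕ → List (List ℕ)
trgsUpTo zero = []
trgsUpTo (suc L) = trgsUpTo L ++ trgsOfLength (suc L)

nth : List (List ℕ) → ℕ → List ℕ
nth [] _ = []
nth (x ∷ xs) zero = x
nth (x ∷ xs) (suc i) = nth xs i

-- b(n); the list of TRGSs of length ≤ n+1 has more than n elements,
-- so the default [] of nth is never used.
b : ℕ → List ℕ
b n = nth (trgsUpTo (suc n)) n

ℓ : ℕ → ℕ
ℓ n = length (b n)

firstNonzero : List ℕ → ℕ
firstNonzero [] = 0
firstNonzero (zero ∷ xs) = suc (firstNonzero xs)
firstNonzero (suc _ ∷ xs) = 1

-- γ(n): position (from the right, rightmost = 1) of rightmost nonzero entry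
γ : ℕ → ℕ
γ n = firstNonzero (reverse (b n))

-- decrease the entry at position p (1-based, from the left) by 1
decAt : ℕ → List ℕ → List ℕ
decAt _ [] = []
decAt zero (x ∷ xs) = x ∷ xs
decAt (suc zero) (x ∷ xs) = (x ∸ 1) ∷ xs
decAt (suc (suc p)) (x ∷ xs) = x ∷ decAt (suc p) xs

-- least m < bound with b(m) = s  (default 0)
findIndex : List ℕ → ℕ → ℕ
findIndex s zero = 0
findIndex s (suc bound) =
  let r = findIndex s bound in
  if does (≡-dec _≟_ (b r) s) then r else
  (if does (≡-dec _≟_ (b bound) s) then bound else 0)

ρ : ℕ → ℕ
ρ n = if γ n ≡ᵇ ℓ n then 0
      else findIndex (reverse (decAt (γ n) (reverse (b n)))) n

insertAt : ℕ → List ℕ → List ℕ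
insertAt K [] = []
insertAt K (x ∷ []) = x ∷ []
insertAt K (x ∷ y ∷ zs) =
  if (x ≡ᵇ K) Data.Bool.∧ (y ≡ᵇ K)
  then x ∷ suc K ∷ suc K ∷ y ∷ zs
  else x ∷ insertAt K (y ∷ zs)

q : List ℕ → List ℕ
q H = insertAt (length H / 2) H

qIter : ℕ → List ℕ → List ℕ
qIter zero H = H
qIter (suc i) H = q (qIter i H)

blowTo : ℕ → List ℕ → List ℕ
blowTo k H = qIter (k ∸ (length H / 2)) H

splitAtVal : ℕ → List ℕ → List ℕ × List ℕ
splitAtVal v [] = [] , []
splitAtVal v (x ∷ xs) =
  if x ≡ᵇ v then ([] , x ∷ xs)
  else (let r = splitAtVal v xs in (x ∷ proj₁ r , proj₂ r))

-- Cast_γ(H) = W Y X Z, with H = W M Z, |W| = γ-1, |Z| = γ,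
-- x the first entry of M, M = X Y where Y begins at the first entry of M
-- after its first entry that is equal to x+1.
castM : List ℕ → List ℕ
castM [] = []
castM (x ∷ ms) =
  let r = splitAtVal (suc x) ms in proj₂ r ++ (x ∷ proj₁ r)

Cast : ℕ → List ℕ → List ℕ
Cast g H =
  let W = take (g ∸ 1) H
      M = drop (g ∸ 1) (take (length H ∸ g) H)
      Z = drop (length H ∸ g) H
  in W ++ castM M ++ Z

-- fuel-bounded recursion; since ρ(n) < n for n ≥ 1, fuel n suffices
Ffuel : ℕ → ℕ → List ℕ
Ffuel _ zero = 1 ∷ 1 ∷ []
Ffuel zero (suc _) = 1 ∷ 1 ∷ []
Ffuel (suc f) (suc n) =
  Cast (γ (suc n)) (blowTo (suc (ℓ (suc n))) (Ffuel f (ρ (suc n))))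

F : ℕ → List ℕ
F n = Ffuel n n

-- Blowing inserts (K+1)(K+1) into the unique top pair K K of a nest of length 2K, while
-- castling with parameter γ only permutes the middle segment M (all but the first γ-1 and the
-- last γ entries).  If the top pair lies in M and the first entry x of M is below K, castling
-- treats the segment K B as a single letter (B = K before blowing, B = (K+1)(K+1)K after):
-- the first occurrence of x+1 in M lies before it, is its initial K, or lies after it.
-- So Cast_γ commutes with q and with all its iterates, provided the blown parent G of F(n)
-- has this shape for γ = γ(n).  That is proved by well-founded induction on n with the
-- invariant F(n) = 1 2 … h M (h+1) … 2 1, where γ(n) = h+1, M contains the top pair and the
-- first entry of M is at most γ(n) + δ(n), δ(n) being the entry of b(n) at position γ(n).
-- The tightness bound γ(n) + δ(n) ≤ ℓ(n) + 1 keeps that first entry below the top value.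

module Submission where

open import Defs
open import Data.Nat using (ℕ; zero; suc; _+_; _*_; _∸_; _≤_; _<_; _≥_; z≤n; s≤s; z<s; _≟_; _≡ᵇ_; _/_)
open import Data.Nat.Properties
open import Data.Nat.DivMod using (m*n/n≡m)
open import Data.Nat.Induction using (<-rec)
open import Data.Bool using (true; false)
open import Data.List using (List; []; _∷_; _++_; length; take; drop; head; reverse; replicate; map)
open import Data.List.Properties
  using (≡-dec; ++-assoc; length-++; length-++-≤ˡ; length-++-comm; length-map; length-replicate; length-reverse;
         reverse-++; reverse-involutive; unfold-reverse; ∷-injectiveˡ; ∷-injectiveʳ)
open import Data.List.Relation.Unary.All as All using (All; []; _∷_)
open import Data.List.Relation.Unary.All.Properties using (++⁺; ++⁻ˡ; ++⁻ʳ; map⁺; concat⁺; all-upTo)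
import Data.Maybe.Relation.Unary.All as Maybe
open import Data.Product using (∃; ∃₂; _×_; _,_; proj₁; proj₂)
open import Data.Unit using (⊤)
open import Data.Sum using (_⊎_; inj₁; inj₂)
open import Relation.Binary.PropositionalEquality
open import Relation.Nullary using (yes; no; does; contradiction)
open import Function using (_∘′_)
open import Relation.Nullary.Decidable using (dec-true; dec-false)
open ≡-Reasoning

≡ᵇ-refl : ∀ n → (n ≡ᵇ n) ≡ true
≡ᵇ-refl n = dec-true (n ≟ n) refl

≢⇒≡ᵇ≡false : ∀ {m n} → m ≢ n → (m ≡ᵇ n) ≡ false
≢⇒≡ᵇ≡false {m} {n} = dec-false (m ≟ n)

[n+n]/2≡n : ∀ n → (n + n) / 2 ≡ n
[n+n]/2≡n n = trans (cong (_/ 2) (sym n*2≡n+n)) (m*n/n≡m n 2)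
  where
  n*2≡n+n : n * 2 ≡ n + n
  n*2≡n+n = trans (*-comm n 2) (cong (n +_) (+-identityʳ n))

take-length-++ : ∀ {a} {X : Set a} (xs ys : List X) → take (length xs) (xs ++ ys) ≡ xs
take-length-++ []       ys = refl
take-length-++ (x ∷ xs) ys = cong (x ∷_) (take-length-++ xs ys)

drop-length-++ : ∀ {a} {X : Set a} (xs ys : List X) → drop (length xs) (xs ++ ys) ≡ ys
drop-length-++ []       ys = refl
drop-length-++ (x ∷ xs) ys = drop-length-++ xs ys

++-regroup : ∀ {a} {X : Set a} (P A B C S : List X) → P ++ (A ++ B ++ C) ++ S ≡ (P ++ A) ++ B ++ C ++ S
++-regroup P A B C S = begin
  P ++ (A ++ B ++ C) ++ S   ≡⟨ cong (P ++_) (++-assoc A (B ++ C) S) ⟩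
  P ++ A ++ (B ++ C) ++ S   ≡⟨ cong (λ Z → P ++ A ++ Z) (++-assoc B C S) ⟩
  P ++ A ++ B ++ C ++ S     ≡⟨ sym (++-assoc P A (B ++ C ++ S)) ⟩
  (P ++ A) ++ B ++ C ++ S   ∎

-- Blowing

insertAt-++ : ∀ {K} A C → All (_< K) A →
  insertAt K (A ++ K ∷ K ∷ C) ≡ A ++ K ∷ suc K ∷ suc K ∷ K ∷ C
insertAt-++ {K} []           C []           rewrite ≡ᵇ-refl K = refl
insertAt-++     (a ∷ [])     C (a<K ∷ [])   rewrite ≢⇒≡ᵇ≡false (<⇒≢ a<K) =
  cong (a ∷_) (insertAt-++ [] C [])
insertAt-++     (a ∷ a′ ∷ A) C (a<K ∷ A<K) rewrite ≢⇒≡ᵇ≡false (<⇒≢ a<K) =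
  cong (a ∷_) (insertAt-++ (a′ ∷ A) C A<K)

q-++ : ∀ {K} A C → All (_< K) A → length (A ++ K ∷ K ∷ C) ≡ K + K →
  q (A ++ K ∷ K ∷ C) ≡ A ++ K ∷ suc K ∷ suc K ∷ K ∷ C
q-++ {K} A C A<K len = begin
  insertAt (length H / 2) H  ≡⟨ cong (λ m → insertAt (m / 2) H) len ⟩
  insertAt ((K + K) / 2) H   ≡⟨ cong (λ k → insertAt k H) ([n+n]/2≡n K) ⟩
  insertAt K H               ≡⟨ insertAt-++ A C A<K ⟩
  A ++ K ∷ suc K ∷ suc K ∷ K ∷ C ∎
  where
  H : List ℕ
  H = A ++ K ∷ K ∷ C

length-blow : ∀ {K} (A C : List ℕ) →
  length (A ++ K ∷ suc K ∷ suc K ∷ K ∷ C) ≡ 2 + length (A ++ K ∷ K ∷ C)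
length-blow []      C = refl
length-blow (a ∷ A) C = cong suc (length-blow A C)

q-grouped : ∀ {K} P A C S → All (_< K) P → All (_< K) A →
  length (P ++ (A ++ K ∷ K ∷ C) ++ S) ≡ K + K →
  q (P ++ (A ++ K ∷ K ∷ C) ++ S) ≡ P ++ (A ++ K ∷ suc K ∷ suc K ∷ K ∷ C) ++ S
q-grouped {K} P A C S P<K A<K len = begin
  q (P ++ (A ++ K ∷ K ∷ C) ++ S)
    ≡⟨ cong q (++-regroup P A _ C S) ⟩
  q ((P ++ A) ++ K ∷ K ∷ C ++ S)
    ≡⟨ q-++ (P ++ A) (C ++ S) (++⁺ P<K A<K) (trans (cong length (sym (++-regroup P A _ C S))) len) ⟩
  (P ++ A) ++ K ∷ suc K ∷ suc K ∷ K ∷ C ++ S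
    ≡⟨ sym (++-regroup P A _ C S) ⟩
  P ++ (A ++ K ∷ suc K ∷ suc K ∷ K ∷ C) ++ S ∎

-- Castling

splitAtVal-absent : ∀ {v} L → All (_≢ v) L → splitAtVal v L ≡ (L , [])
splitAtVal-absent         []      []           = refl
splitAtVal-absent {v} (x ∷ L) (x≢v ∷ L∌v)
  rewrite ≢⇒≡ᵇ≡false x≢v | splitAtVal-absent L L∌v = refl

splitAtVal-first : ∀ {v} L₁ L₂ → All (_≢ v) L₁ → splitAtVal v (L₁ ++ v ∷ L₂) ≡ (L₁ , v ∷ L₂)
splitAtVal-first {v} []       L₂ []           rewrite ≡ᵇ-refl v = refl
splitAtVal-first     (x ∷ L₁) L₂ (x≢v ∷ L₁∌v)
  rewrite ≢⇒≡ᵇ≡false x≢v | splitAtVal-first L₁ L₂ L₁∌v = refl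

splitAtVal-++ : ∀ v L → proj₁ (splitAtVal v L) ++ proj₂ (splitAtVal v L) ≡ L
splitAtVal-++ v []      = refl
splitAtVal-++ v (x ∷ L) with x ≡ᵇ v
... | true  = refl
... | false = cong (x ∷_) (splitAtVal-++ v L)

first-occurrence : ∀ v L →
  All (_≢ v) L ⊎ ∃₂ λ L₁ L₂ → L ≡ L₁ ++ v ∷ L₂ × All (_≢ v) L₁
first-occurrence v []      = inj₁ []
first-occurrence v (x ∷ L) with x ≟ v | first-occurrence v L
... | yes refl | _                             = inj₂ ([] , L , refl , [])
... | no x≢v   | inj₁ L∌v                      = inj₁ (x≢v ∷ L∌v)
... | no x≢v   | inj₂ (L₁ , L₂ , refl , L₁∌v) = inj₂ (x ∷ L₁ , L₂ , refl , x≢v ∷ L₁∌v)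

length-castM : ∀ M → length (castM M) ≡ length M
length-castM []       = refl
length-castM (x ∷ ms) = trans (length-++-comm Y (x ∷ X)) (cong (suc ∘′ length) (splitAtVal-++ (suc x) ms))
  where
  X Y : List ℕ
  X = proj₁ (splitAtVal (suc x) ms)
  Y = proj₂ (splitAtVal (suc x) ms)

castM-∷ : ∀ {x} ms {X Y} → splitAtVal (suc x) ms ≡ (X , Y) → castM (x ∷ ms) ≡ Y ++ x ∷ X
castM-∷ {x} _ = cong (λ r → proj₂ r ++ x ∷ proj₁ r)

Cast-++ : ∀ P M S → length S ≡ suc (length P) →
  Cast (suc (length P)) (P ++ M ++ S) ≡ P ++ castM M ++ S
Cast-++ P M S lenS = begin
  take p H ++ castM (drop p (take (length H ∸ suc p) H)) ++ drop (length H ∸ suc p) H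
    ≡⟨ cong (λ k → take p H ++ castM (drop p (take k H)) ++ drop k H) cut ⟩
  take p H ++ castM (drop p (take (length (P ++ M)) H)) ++ drop (length (P ++ M)) H
    ≡⟨ cong₂ (λ T Z → take p H ++ castM (drop p T) ++ Z)
         (trans (cong (take (length (P ++ M))) H≡) (take-length-++ (P ++ M) S))
         (trans (cong (drop (length (P ++ M))) H≡) (drop-length-++ (P ++ M) S)) ⟩
  take p H ++ castM (drop p (P ++ M)) ++ S
    ≡⟨ cong₂ (λ W M′ → W ++ castM M′ ++ S) (take-length-++ P (M ++ S)) (drop-length-++ P M) ⟩
  P ++ castM M ++ S ∎
  where
  p : ℕ
  p = length P
  H : List ℕ
  H = P ++ M ++ S
  H≡ : H ≡ (P ++ M) ++ S
  H≡ = sym (++-assoc P M S)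
  cut : length H ∸ suc p ≡ length (P ++ M)
  cut = begin
    length H ∸ suc p                  ≡⟨ cong (λ L → length L ∸ suc p) H≡ ⟩
    length ((P ++ M) ++ S) ∸ suc p    ≡⟨ cong (_∸ suc p) (length-++ (P ++ M)) ⟩
    length (P ++ M) + length S ∸ suc p ≡⟨ cong (λ l → length (P ++ M) + l ∸ suc p) lenS ⟩
    length (P ++ M) + suc p ∸ suc p   ≡⟨ m+n∸n≡m (length (P ++ M)) (suc p) ⟩
    length (P ++ M)                   ∎

All-≥⇒∌ : ∀ {v K B} → v < K → All (K ≤_) B → All (_≢ v) B
All-≥⇒∌ v<K = All.map (λ K≤b → >⇒≢ (<-≤-trans v<K K≤b))

record CastOfBlock (K x : ℕ) (D E : List ℕ) : Set where
  field
    A C : List ℕ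
    A<K : All (_< K) A
    C<K : All (_< K) C
    head≤ : Maybe.All (_≤ suc x) (head (A ++ K ∷ K ∷ C))
    castM-block : ∀ B → All (K ≤_) B → castM (x ∷ D ++ K ∷ B ++ E) ≡ A ++ K ∷ B ++ C

castM-block-view : ∀ {K x} D E → x < K → All (_< K) D → All (_< K) E → CastOfBlock K x D E
castM-block-view {K} {x} D E x<K D<K E<K with first-occurrence (suc x) D
... | inj₂ (D₁ , D₂ , refl , D₁∌) = record
  { A = suc x ∷ D₂ ; C = E ++ x ∷ D₁
  ; A<K = ++⁻ʳ D₁ D<K ; C<K = ++⁺ E<K (x<K ∷ ++⁻ˡ D₁ D<K) ; head≤ = Maybe.just ≤-refl
  ; castM-block = λ B _ → begin
      castM (x ∷ (D₁ ++ suc x ∷ D₂) ++ K ∷ B ++ E)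
        ≡⟨ castM-∷ ((D₁ ++ suc x ∷ D₂) ++ K ∷ B ++ E)
             (trans (cong (splitAtVal (suc x)) (++-assoc D₁ (suc x ∷ D₂) _))
                    (splitAtVal-first D₁ _ D₁∌)) ⟩
      (suc x ∷ D₂ ++ K ∷ B ++ E) ++ x ∷ D₁
        ≡⟨ ++-assoc (suc x ∷ D₂) (K ∷ B ++ E) _ ⟩
      suc x ∷ D₂ ++ K ∷ (B ++ E) ++ x ∷ D₁
        ≡⟨ cong (λ Z → suc x ∷ D₂ ++ K ∷ Z) (++-assoc B E _) ⟩
      suc x ∷ D₂ ++ K ∷ B ++ E ++ x ∷ D₁ ∎ }
... | inj₁ D∌ with suc x ≟ K
...   | yes refl = record
  { A = [] ; C = E ++ x ∷ D
  ; A<K = [] ; C<K = ++⁺ E<K (x<K ∷ D<K) ; head≤ = Maybe.just ≤-refl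
  ; castM-block = λ B _ →
      trans (castM-∷ (D ++ K ∷ B ++ E) (splitAtVal-first D _ D∌)) (cong (K ∷_) (++-assoc B E _)) }
...   | no x+1≢K with first-occurrence (suc x) E | ≤∧≢⇒< x<K x+1≢K
...     | inj₂ (E₁ , E₂ , refl , E₁∌) | x+1<K = record
  { A = suc x ∷ E₂ ++ x ∷ D ; C = E₁
  ; A<K = ++⁺ (++⁻ʳ E₁ E<K) (x<K ∷ D<K) ; C<K = ++⁻ˡ E₁ E<K ; head≤ = Maybe.just ≤-refl
  ; castM-block = λ B K≤B → begin
      castM (x ∷ D ++ K ∷ B ++ E₁ ++ suc x ∷ E₂)
        ≡⟨ castM-∷ (D ++ K ∷ B ++ E₁ ++ suc x ∷ E₂)
             (trans (cong (splitAtVal (suc x)) (regroup B))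
                    (splitAtVal-first (D ++ K ∷ B ++ E₁) E₂
                       (++⁺ D∌ (++⁺ (All-≥⇒∌ x+1<K (≤-refl ∷ K≤B)) E₁∌)))) ⟩
      suc x ∷ E₂ ++ x ∷ D ++ K ∷ B ++ E₁
        ≡⟨ cong (suc x ∷_) (sym (++-assoc E₂ (x ∷ D) _)) ⟩
      suc x ∷ (E₂ ++ x ∷ D) ++ K ∷ B ++ E₁ ∎ }
  where
  regroup : ∀ B → D ++ K ∷ B ++ E₁ ++ suc x ∷ E₂ ≡ (D ++ K ∷ B ++ E₁) ++ suc x ∷ E₂
  regroup B = sym (trans (++-assoc D (K ∷ B ++ E₁) _) (cong (λ Z → D ++ K ∷ Z) (++-assoc B E₁ _)))
...     | inj₁ E∌ | x+1<K = record
  { A = x ∷ D ; C = E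
  ; A<K = x<K ∷ D<K ; C<K = E<K ; head≤ = Maybe.just (n≤1+n x)
  ; castM-block = λ B K≤B →
      castM-∷ (D ++ K ∷ B ++ E)
        (splitAtVal-absent _ (++⁺ D∌ (++⁺ (All-≥⇒∌ x+1<K (≤-refl ∷ K≤B)) E∌))) }

length-middle : ∀ {a} {X : Set a} (P M M′ S : List X) →
  length M ≡ length M′ → length (P ++ M ++ S) ≡ length (P ++ M′ ++ S)
length-middle P M M′ S eq rewrite length-++ P {M ++ S} | length-++ P {M′ ++ S}
  | length-++ M {S} | length-++ M′ {S} | eq = refl

record CastShape (K : ℕ) (P : List ℕ) (x : ℕ) (S H : List ℕ) : Set where
  field
    D E : List ℕ
    H≡ : H ≡ P ++ (x ∷ D ++ K ∷ K ∷ E) ++ S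
    length-S : length S ≡ suc (length P)
    length-H : length H ≡ K + K
    P<K : All (_< K) P
    x<K : x < K
    D<K : All (_< K) D
    E<K : All (_< K) E

module _ {K P x S H} (shape : CastShape K P x S H) where
  open CastShape shape

  castView : CastOfBlock K x D E
  castView = castM-block-view D E x<K D<K E<K

  open CastOfBlock castView

  castM-pair : castM (x ∷ D ++ K ∷ K ∷ E) ≡ A ++ K ∷ K ∷ C
  castM-pair = castM-block (K ∷ []) (≤-refl ∷ [])

  Cast-shape : Cast (suc (length P)) H ≡ P ++ (A ++ K ∷ K ∷ C) ++ S
  Cast-shape = begin
    Cast (suc (length P)) H
      ≡⟨ cong (Cast (suc (length P))) H≡ ⟩
    Cast (suc (length P)) (P ++ (x ∷ D ++ K ∷ K ∷ E) ++ S)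
      ≡⟨ Cast-++ P _ S length-S ⟩
    P ++ castM (x ∷ D ++ K ∷ K ∷ E) ++ S
      ≡⟨ cong (λ M → P ++ M ++ S) castM-pair ⟩
    P ++ (A ++ K ∷ K ∷ C) ++ S ∎

  length-Cast-shape : length (P ++ (A ++ K ∷ K ∷ C) ++ S) ≡ K + K
  length-Cast-shape = begin
    length (P ++ (A ++ K ∷ K ∷ C) ++ S)
      ≡⟨ cong (λ M → length (P ++ M ++ S)) castM-pair ⟨
    length (P ++ castM (x ∷ D ++ K ∷ K ∷ E) ++ S)
      ≡⟨ length-middle P _ _ S (length-castM (x ∷ D ++ K ∷ K ∷ E)) ⟩
    length (P ++ (x ∷ D ++ K ∷ K ∷ E) ++ S)
      ≡⟨ cong length H≡ ⟨
    length H
      ≡⟨ length-H ⟩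
    K + K ∎

  q-shape : q H ≡ P ++ (x ∷ D ++ K ∷ suc K ∷ suc K ∷ K ∷ E) ++ S
  q-shape = trans (cong q H≡) (q-grouped P (x ∷ D) E S P<K (x<K ∷ D<K) (trans (cong length (sym H≡)) length-H))

  length-q : length (q H) ≡ suc K + suc K
  length-q = begin
    length (q H)
      ≡⟨ cong length (trans q-shape (++-regroup P (x ∷ D) _ E S)) ⟩
    length ((P ++ x ∷ D) ++ K ∷ suc K ∷ suc K ∷ K ∷ E ++ S)
      ≡⟨ length-blow (P ++ x ∷ D) (E ++ S) ⟩
    2 + length ((P ++ x ∷ D) ++ K ∷ K ∷ E ++ S)
      ≡⟨ cong (λ L → 2 + length L) (trans H≡ (++-regroup P (x ∷ D) _ E S)) ⟨
    2 + length H
      ≡⟨ cong (2 +_) length-H ⟩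
    2 + (K + K)
      ≡⟨ cong suc (+-suc K K) ⟨
    suc K + suc K ∎

  q-CastShape : CastShape (suc K) P x S (q H)
  q-CastShape = record
    { D = D ++ K ∷ [] ; E = K ∷ E
    ; H≡ = trans q-shape (cong (λ M → P ++ (x ∷ M) ++ S) (sym (++-assoc D (K ∷ []) _)))
    ; length-S = length-S
    ; length-H = length-q
    ; P<K = All.map m<n⇒m<1+n P<K ; x<K = m<n⇒m<1+n x<K
    ; D<K = ++⁺ (All.map m<n⇒m<1+n D<K) (n<1+n K ∷ [])
    ; E<K = n<1+n K ∷ All.map m<n⇒m<1+n E<K
    }

  Cast-q-comm : Cast (suc (length P)) (q H) ≡ q (Cast (suc (length P)) H)
  Cast-q-comm = begin
    Cast (suc (length P)) (q H)
      ≡⟨ cong (Cast (suc (length P))) q-shape ⟩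
    Cast (suc (length P)) (P ++ (x ∷ D ++ K ∷ suc K ∷ suc K ∷ K ∷ E) ++ S)
      ≡⟨ Cast-++ P _ S length-S ⟩
    P ++ castM (x ∷ D ++ K ∷ suc K ∷ suc K ∷ K ∷ E) ++ S
      ≡⟨ cong (λ M → P ++ M ++ S)
           (castM-block (suc K ∷ suc K ∷ K ∷ []) (n≤1+n K ∷ n≤1+n K ∷ ≤-refl ∷ [])) ⟩
    P ++ (A ++ K ∷ suc K ∷ suc K ∷ K ∷ C) ++ S
      ≡⟨ q-grouped P A C S P<K A<K length-Cast-shape ⟨
    q (P ++ (A ++ K ∷ K ∷ C) ++ S)
      ≡⟨ cong q Cast-shape ⟨
    q (Cast (suc (length P)) H) ∎

qIter-CastShape : ∀ i {K P x S H} → CastShape K P x S H → CastShape (i + K) P x S (qIter i H)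
qIter-CastShape zero    shape = shape
qIter-CastShape (suc i) shape = q-CastShape (qIter-CastShape i shape)

Cast-qIter-comm : ∀ i {K P x S H} → CastShape K P x S H →
  Cast (suc (length P)) (qIter i H) ≡ qIter i (Cast (suc (length P)) H)
Cast-qIter-comm zero    shape = refl
Cast-qIter-comm (suc i) shape =
  trans (Cast-q-comm (qIter-CastShape i shape)) (cong q (Cast-qIter-comm i shape))

-- Tight restricted-growth strings

GrowthBound : ℕ → List ℕ → Set
GrowthBound k []       = ⊤
GrowthBound k (x ∷ xs) = x ≤ k × GrowthBound (suc k) xs

GrowthBound-mono : ∀ {k k′} xs → k ≤ k′ → GrowthBound k xs → GrowthBound k′ xs
GrowthBound-mono []       k≤k′ _          = _
GrowthBound-mono (x ∷ xs) k≤k′ (x≤k , gb) = ≤-trans x≤k k≤k′ , GrowthBound-mono xs (s≤s k≤k′) gb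

GrowthBound-at : ∀ k U {y V} → GrowthBound k (U ++ y ∷ V) → y ≤ k + length U
GrowthBound-at k []      (y≤k , _) = ≤-trans y≤k (≤-reflexive (sym (+-identityʳ k)))
GrowthBound-at k (u ∷ U) (_ , gb)  = ≤-trans (GrowthBound-at (suc k) U gb) (≤-reflexive (sym (+-suc k (length U))))

ext-growth : ∀ p m → All (GrowthBound (suc p)) (ext p m)
ext-growth p zero    = _ ∷ []
ext-growth p (suc m) = concat⁺ (map⁺ (All.map extend (all-upTo (suc (suc p)))))
  where
  extend : ∀ {c} → c < suc (suc p) → All (GrowthBound (suc p)) (map (c ∷_) (ext c m))
  extend (s≤s c≤1+p) = map⁺ (All.map (λ gb → c≤1+p , GrowthBound-mono _ (s≤s c≤1+p) gb) (ext-growth _ m))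

ext-nonempty : ∀ p m → 0 < length (ext p m)
ext-nonempty p zero    = ≤-refl
ext-nonempty p (suc m) =
  ≤-trans (ext-nonempty 0 m)
    (≤-trans (≤-reflexive (sym (length-map (0 ∷_) (ext 0 m)))) (length-++-≤ˡ (map (0 ∷_) (ext 0 m))))

data Tight : List ℕ → Set where
  tight : ∀ {ys} → GrowthBound 2 ys → Tight (1 ∷ ys)

trgsUpTo-tight : ∀ m → ∃ λ R → trgsUpTo (suc m) ≡ (0 ∷ []) ∷ R × All Tight R × suc m ≤ length R
trgsUpTo-tight zero    = (1 ∷ []) ∷ [] , refl , tight _ ∷ [] , ≤-refl
trgsUpTo-tight (suc m) with trgsUpTo-tight m
... | R , eq , R-tight , m<|R| =
  R ++ new , cong (_++ new) eq , ++⁺ R-tight (map⁺ (All.map tight (ext-growth 1 (suc m)))) , longer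
  where
  new : List (List ℕ)
  new = map (1 ∷_) (ext 1 (suc m))
  longer : suc (suc m) ≤ length (R ++ new)
  longer = ≤-trans (s≤s m<|R|) (≤-trans (m<m+n (length R) new-nonempty) (≤-reflexive (sym (length-++ R))))
    where
    new-nonempty : 0 < length new
    new-nonempty = ≤-trans (ext-nonempty 1 (suc m)) (≤-reflexive (sym (length-map (1 ∷_) (ext 1 (suc m)))))

All-nth : ∀ {P : List ℕ → Set} xs {i} → All P xs → i < length xs → P (nth xs i)
All-nth (x ∷ xs) {zero}  (px ∷ _)   _         = px
All-nth (x ∷ xs) {suc i} (_ ∷ pxs) (s≤s i<n) = All-nth xs pxs i<n

b-tight : ∀ n → Tight (b (suc n))
b-tight n with trgsUpTo-tight (suc n)
... | R , eq , R-tight , n<|R| rewrite eq = All-nth R R-tight (≤-trans (n≤1+n _) n<|R|)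

firstNonzeroValue : List ℕ → ℕ
firstNonzeroValue []           = 0
firstNonzeroValue (zero ∷ xs)  = firstNonzeroValue xs
firstNonzeroValue (suc c ∷ xs) = suc c

δ : ℕ → ℕ
δ n = firstNonzeroValue (reverse (b n))

zeros-view : ∀ U k V → ∃ λ j → ∃₂ λ c rest → U ++ suc k ∷ V ≡ replicate j 0 ++ suc c ∷ rest
zeros-view []          k V = 0 , k , V , refl
zeros-view (suc u ∷ U) k V = 0 , u , U ++ suc k ∷ V , refl
zeros-view (zero ∷ U)  k V with zeros-view U k V
... | j , c , rest , eq = suc j , c , rest , cong (0 ∷_) eq

firstNonzero-zeros : ∀ j {c rest} → firstNonzero (replicate j 0 ++ suc c ∷ rest) ≡ suc j
firstNonzero-zeros zero    = refl
firstNonzero-zeros (suc j) = cong suc (firstNonzero-zeros j)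

firstNonzeroValue-zeros : ∀ j {c rest} → firstNonzeroValue (replicate j 0 ++ suc c ∷ rest) ≡ suc c
firstNonzeroValue-zeros zero    = refl
firstNonzeroValue-zeros (suc j) = firstNonzeroValue-zeros j

decAt-zeros : ∀ j {c rest} → decAt (suc j) (replicate j 0 ++ suc c ∷ rest) ≡ replicate j 0 ++ c ∷ rest
decAt-zeros zero          = refl
decAt-zeros (suc zero)    = refl
decAt-zeros (suc (suc j)) = cong (0 ∷_) (decAt-zeros (suc j))

zeros-compare : ∀ j j′ {c d rest rest′} → replicate j 0 ++ c ∷ rest ≡ replicate j′ 0 ++ suc d ∷ rest′ →
  (j ≡ j′ × c ≡ suc d) ⊎ j < j′
zeros-compare zero    zero     eq = inj₁ (refl , ∷-injectiveˡ eq)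
zeros-compare zero    (suc j′) eq = inj₂ z<s
zeros-compare (suc j) zero     ()
zeros-compare (suc j) (suc j′) eq with zeros-compare j j′ (∷-injectiveʳ eq)
... | inj₁ (j≡j′ , c≡) = inj₁ (cong suc j≡j′ , c≡)
... | inj₂ j<j′        = inj₂ (s≤s j<j′)

record RightmostNonzero (xs : List ℕ) : Set where
  field
    j c : ℕ
    rest : List ℕ
    reverse≡ : reverse xs ≡ replicate j 0 ++ suc c ∷ rest
    bound : suc j + suc c ≤ suc (length xs)

tight-rightmost : ∀ {xs} → Tight xs → RightmostNonzero xs
tight-rightmost {1 ∷ ys} (tight gb) with zeros-view (reverse ys) 0 []
... | j , c , rest , eq = record { j = j ; c = c ; rest = rest ; reverse≡ = reverse≡ ; bound = bound }
  where
  Z : List ℕ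
  Z = replicate j 0
  reverse≡ : reverse (1 ∷ ys) ≡ Z ++ suc c ∷ rest
  reverse≡ = trans (unfold-reverse 1 ys) eq
  xs≡ : 1 ∷ ys ≡ reverse rest ++ suc c ∷ reverse Z
  xs≡ = begin
    1 ∷ ys                                ≡⟨ reverse-involutive (1 ∷ ys) ⟨
    reverse (reverse (1 ∷ ys))            ≡⟨ cong reverse reverse≡ ⟩
    reverse (Z ++ suc c ∷ rest)           ≡⟨ reverse-++ Z (suc c ∷ rest) ⟩
    reverse (suc c ∷ rest) ++ reverse Z   ≡⟨ cong (_++ reverse Z) (unfold-reverse (suc c) rest) ⟩
    (reverse rest ++ suc c ∷ []) ++ reverse Z ≡⟨ ++-assoc (reverse rest) _ _ ⟩
    reverse rest ++ suc c ∷ reverse Z     ∎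
  c<|rest| : suc c ≤ suc (length rest)
  c<|rest| = ≤-trans (GrowthBound-at 1 (reverse rest) (subst (GrowthBound 1) xs≡ (≤-refl , gb)))
                     (≤-reflexive (cong suc (length-reverse rest)))
  length≡ : length (1 ∷ ys) ≡ j + suc (length rest)
  length≡ = begin
    length (1 ∷ ys)               ≡⟨ length-reverse (1 ∷ ys) ⟨
    length (reverse (1 ∷ ys))     ≡⟨ cong length reverse≡ ⟩
    length (Z ++ suc c ∷ rest)    ≡⟨ length-++ Z ⟩
    length Z + suc (length rest)  ≡⟨ cong (_+ suc (length rest)) (length-replicate j) ⟩
    j + suc (length rest)         ∎
  bound : suc j + suc c ≤ suc (length (1 ∷ ys))
  bound = ≤-trans (+-monoʳ-≤ (suc j) c<|rest|) (≤-reflexive (cong suc (sym length≡)))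

rightmost : ∀ n → RightmostNonzero (b (suc n))
rightmost n = tight-rightmost (b-tight n)

module _ (n : ℕ) where
  open RightmostNonzero (rightmost n)

  γ-rightmost : γ (suc n) ≡ suc j
  γ-rightmost = trans (cong firstNonzero reverse≡) (firstNonzero-zeros j)

  δ-rightmost : δ (suc n) ≡ suc c
  δ-rightmost = trans (cong firstNonzeroValue reverse≡) (firstNonzeroValue-zeros j)

  decAt-rightmost : decAt (γ (suc n)) (reverse (b (suc n))) ≡ replicate j 0 ++ c ∷ rest
  decAt-rightmost = trans (cong₂ decAt γ-rightmost reverse≡) (decAt-zeros j)

  γ+δ≤ : γ (suc n) + δ (suc n) ≤ suc (ℓ (suc n))
  γ+δ≤ = subst₂ (λ g d → g + d ≤ suc (ℓ (suc n))) (sym γ-rightmost) (sym δ-rightmost) bound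

  δ-pos : 0 < δ (suc n)
  δ-pos = subst (0 <_) (sym δ-rightmost) z<s

  γ<ℓ+1 : γ (suc n) < suc (ℓ (suc n))
  γ<ℓ+1 = <-≤-trans (m<m+n (γ (suc n)) δ-pos) γ+δ≤

-- The parent map

findIndex-≤ : ∀ s bound → findIndex s bound ≤ bound
findIndex-suc-≤ : ∀ s bound → findIndex s (suc bound) ≤ bound

findIndex-≤ s zero        = z≤n
findIndex-≤ s (suc bound) = m≤n⇒m≤1+n (findIndex-suc-≤ s bound)

findIndex-suc-≤ s bound with does (≡-dec _≟_ (b (findIndex s bound)) s)
... | true  = findIndex-≤ s bound
... | false with does (≡-dec _≟_ (b bound) s)
...   | true  = ≤-refl
...   | false = z≤n

findIndex-spec : ∀ s bound → findIndex s bound ≡ 0 ⊎ b (findIndex s bound) ≡ s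
findIndex-spec s zero        = inj₁ refl
findIndex-spec s (suc bound) with ≡-dec _≟_ (b (findIndex s bound)) s
... | yes eq = inj₂ eq
... | no _ with ≡-dec _≟_ (b bound) s
...   | yes eq = inj₂ eq
...   | no _   = inj₁ refl

ρ-≤ : ∀ n → ρ (suc n) ≤ n
ρ-≤ n with γ (suc n) ≡ᵇ ℓ (suc n)
... | true  = z≤n
... | false = findIndex-suc-≤ _ n

ρ-spec : ∀ n → ρ n ≡ 0 ⊎ b (ρ n) ≡ reverse (decAt (γ n) (reverse (b n)))
ρ-spec n with γ n ≡ᵇ ℓ n
... | true  = inj₁ refl
... | false = findIndex-spec _ n

data ParentCase (n m : ℕ) : Set where
  same-γ   : γ m ≡ γ n → δ n ≡ suc (δ m) → ParentCase n m
  larger-γ : γ n < γ m → ParentCase n m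

parent-case : ∀ n m → ρ (suc n) ≡ suc m → ℓ (suc m) ≡ ℓ (suc n) × ParentCase (suc n) (suc m)
parent-case n m ρ≡ with ρ-spec (suc n)
... | inj₁ ρ≡0 = contradiction (trans (sym ρ≡0) ρ≡) 0≢1+n
... | inj₂ b-ρ = ℓ≡ , case
  where
  open RightmostNonzero (rightmost n)
  reverse-b : reverse (b (suc m)) ≡ replicate j 0 ++ c ∷ rest
  reverse-b = begin
    reverse (b (suc m))                                  ≡⟨ cong (reverse ∘′ b) ρ≡ ⟨
    reverse (b (ρ (suc n)))                              ≡⟨ cong reverse b-ρ ⟩
    reverse (reverse (decAt (γ (suc n)) (reverse (b (suc n))))) ≡⟨ reverse-involutive _ ⟩
    decAt (γ (suc n)) (reverse (b (suc n)))             ≡⟨ decAt-rightmost n ⟩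
    replicate j 0 ++ c ∷ rest                           ∎
  ℓ≡ : ℓ (suc m) ≡ ℓ (suc n)
  ℓ≡ = begin
    length (b (suc m))                   ≡⟨ length-reverse (b (suc m)) ⟨
    length (reverse (b (suc m)))         ≡⟨ cong length reverse-b ⟩
    length (replicate j 0 ++ c ∷ rest)   ≡⟨ length-++ (replicate j 0) ⟩
    length (replicate j 0) + suc (length rest) ≡⟨ length-++ (replicate j 0) ⟨
    length (replicate j 0 ++ suc c ∷ rest) ≡⟨ cong length reverse≡ ⟨
    length (reverse (b (suc n)))         ≡⟨ length-reverse (b (suc n)) ⟩
    length (b (suc n))                   ∎
  case : ParentCase (suc n) (suc m)
  case with zeros-compare j _ (trans (sym reverse-b) (RightmostNonzero.reverse≡ (rightmost m)))
  ... | inj₁ (j≡j′ , c≡) = same-γ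
    (trans (γ-rightmost m) (trans (cong suc (sym j≡j′)) (sym (γ-rightmost n))))
    (trans (δ-rightmost n) (cong suc (trans c≡ (sym (δ-rightmost m)))))
  ... | inj₂ j<j′ = larger-γ (subst₂ _<_ (sym (γ-rightmost n)) (sym (γ-rightmost m)) (s≤s j<j′))

Ffuel-stable : ∀ f f′ m → m ≤ f → m ≤ f′ → Ffuel f m ≡ Ffuel f′ m
Ffuel-stable f        f′        zero    _          _           = refl
Ffuel-stable (suc f) (suc f′) (suc m) (s≤s m≤f) (s≤s m≤f′) =
  cong (λ H → Cast (γ (suc m)) (blowTo (suc (ℓ (suc m))) H))
       (Ffuel-stable f f′ (ρ (suc m)) (≤-trans (ρ-≤ m) m≤f) (≤-trans (ρ-≤ m) m≤f′))

F-suc : ∀ n → F (suc n) ≡ Cast (γ (suc n)) (blowTo (suc (ℓ (suc n))) (F (ρ (suc n))))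
F-suc n = cong (λ H → Cast (γ (suc n)) (blowTo (suc (ℓ (suc n))) H))
  (Ffuel-stable n (ρ (suc n)) (ρ (suc n)) (ρ-≤ n) ≤-refl)

-- Ascending and descending runs

asc : ℕ → ℕ → List ℕ
asc a zero    = []
asc a (suc n) = a ∷ asc (suc a) n

desc : ℕ → ℕ → List ℕ
desc a zero    = []
desc a (suc n) = a + n ∷ desc a n

length-asc : ∀ a n → length (asc a n) ≡ n
length-asc a zero    = refl
length-asc a (suc n) = cong suc (length-asc (suc a) n)

length-desc : ∀ a n → length (desc a n) ≡ n
length-desc a zero    = refl
length-desc a (suc n) = cong suc (length-desc a n)

asc-+ : ∀ a m n → asc a (m + n) ≡ asc a m ++ asc (a + m) n
asc-+ a zero    n = cong (λ a′ → asc a′ n) (sym (+-identityʳ a))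
asc-+ a (suc m) n =
  cong (a ∷_) (trans (asc-+ (suc a) m n) (cong (λ a′ → asc (suc a) m ++ asc a′ n) (sym (+-suc a m))))

asc-suc : ∀ a n → asc a (suc n) ≡ asc a n ++ a + n ∷ []
asc-suc a n = trans (cong (asc a) (+-comm 1 n)) (asc-+ a n 1)

desc-+ : ∀ a m n → desc a (m + n) ≡ desc (a + m) n ++ desc a m
desc-+ a m zero    = cong (desc a) (+-identityʳ m)
desc-+ a m (suc n) = begin
  desc a (m + suc n)               ≡⟨ cong (desc a) (+-suc m n) ⟩
  a + (m + n) ∷ desc a (m + n)     ≡⟨ cong₂ _∷_ (sym (+-assoc a m n)) (desc-+ a m n) ⟩
  a + m + n ∷ desc (a + m) n ++ desc a m ∎

asc-< : ∀ {K} a n → a + n ≤ K → All (_< K) (asc a n)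
asc-< a zero    _     = []
asc-< a (suc n) a+n≤K rewrite +-suc a n = ≤-trans (s≤s (m≤m+n a n)) a+n≤K ∷ asc-< (suc a) n a+n≤K

desc-< : ∀ {K} a n → a + n ≤ K → All (_< K) (desc a n)
desc-< a zero    _     = []
desc-< a (suc n) a+n≤K rewrite +-suc a n = a+n≤K ∷ desc-< a n (<⇒≤ a+n≤K)

asc-prefix : ∀ {K h u} → h < u → u < K → ∃ λ R → asc 1 u ≡ asc 1 h ++ suc h ∷ R × All (_< K) R
asc-prefix {K} {h} h<u u<K with m≤n⇒∃[o]m+o≡n h<u
... | t , refl = asc (2 + h) t , split , asc-< (2 + h) t u<K
  where
  split : asc 1 (suc h + t) ≡ asc 1 h ++ suc h ∷ asc (2 + h) t
  split = trans (asc-+ 1 (suc h) t) (trans (cong (_++ asc (2 + h) t) (asc-suc 1 h)) (++-assoc (asc 1 h) _ _))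

desc-suffix : ∀ {K h v} → h < v → v < K → ∃ λ R → desc 1 v ≡ R ++ desc 1 (suc h) × All (_< K) R
desc-suffix {K} {h} h<v v<K with m≤n⇒∃[o]m+o≡n h<v
... | t , refl = desc (2 + h) t , desc-+ 1 (suc h) t , desc-< (2 + h) t v<K

++-regroup-around : ∀ {K} (P : List ℕ) x U A C V S →
  (P ++ x ∷ U) ++ (A ++ K ∷ K ∷ C) ++ (V ++ S) ≡ P ++ (x ∷ (U ++ A) ++ K ∷ K ∷ C ++ V) ++ S
++-regroup-around (p ∷ P) x U       A       C V S = cong (p ∷_) (++-regroup-around P x U A C V S)
++-regroup-around []      x (u ∷ U) A       C V S = cong (x ∷_) (++-regroup-around [] u U A C V S)
++-regroup-around []      x []      (a ∷ A) C V S = cong (x ∷_) (++-regroup-around [] a [] A C V S)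
++-regroup-around {K} []  x []      []      C V S = cong (λ Z → x ∷ K ∷ K ∷ Z) (sym (++-assoc C V S))

CastShape-below : ∀ {K h u v A C H} → H ≡ asc 1 u ++ (A ++ K ∷ K ∷ C) ++ desc 1 v →
  h < u → u < K → h < v → v < K → All (_< K) A → All (_< K) C → length H ≡ K + K →
  CastShape K (asc 1 h) (suc h) (desc 1 (suc h)) H
CastShape-below {K} {h} {u} {v} {A} {C} H≡ h<u u<K h<v v<K A<K C<K length-H
  with asc-prefix h<u u<K | desc-suffix h<v v<K
... | R₁ , asc≡ , R₁<K | R₂ , desc≡ , R₂<K = record
  { D = R₁ ++ A ; E = C ++ R₂
  ; H≡ = trans H≡ (trans (cong₂ (λ U W → U ++ (A ++ K ∷ K ∷ C) ++ W) asc≡ desc≡)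
                         (++-regroup-around (asc 1 h) (suc h) R₁ A C R₂ _))
  ; length-S = trans (length-desc 1 (suc h)) (cong suc (sym (length-asc 1 h)))
  ; length-H = length-H
  ; P<K = asc-< 1 h (<-trans h<u u<K)
  ; x<K = ≤-trans (s≤s h<u) u<K
  ; D<K = ++⁺ R₁<K A<K
  ; E<K = ++⁺ C<K R₂<K
  }

pyramid : ℕ → List ℕ
pyramid L = asc 1 L ++ suc L ∷ suc L ∷ desc 1 L

length-pyramid : ∀ L → length (pyramid L) ≡ suc L + suc L
length-pyramid L = begin
  length (pyramid L)
    ≡⟨ length-++ (asc 1 L) ⟩
  length (asc 1 L) + suc (suc (length (desc 1 L)))
    ≡⟨ cong₂ (λ a d → a + suc (suc d)) (length-asc 1 L) (length-desc 1 L) ⟩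
  L + suc (suc L)
    ≡⟨ +-suc L (suc L) ⟩
  suc L + suc L ∎

qIter-pyramid : ∀ L → qIter L (1 ∷ 1 ∷ []) ≡ pyramid L
qIter-pyramid zero    = refl
qIter-pyramid (suc L) = begin
  q (qIter L (1 ∷ 1 ∷ []))
    ≡⟨ cong q (qIter-pyramid L) ⟩
  q (asc 1 L ++ suc L ∷ suc L ∷ desc 1 L)
    ≡⟨ q-++ (asc 1 L) (desc 1 L) (asc-< 1 L ≤-refl) (length-pyramid L) ⟩
  asc 1 L ++ suc L ∷ suc (suc L) ∷ suc (suc L) ∷ suc L ∷ desc 1 L
    ≡⟨ ++-assoc (asc 1 L) (suc L ∷ []) _ ⟨
  (asc 1 L ++ suc L ∷ []) ++ suc (suc L) ∷ suc (suc L) ∷ desc 1 (suc L)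
    ≡⟨ cong (_++ suc (suc L) ∷ suc (suc L) ∷ desc 1 (suc L)) (asc-suc 1 L) ⟨
  pyramid (suc L) ∎

CastShape-at : ∀ {K h y A C H} → H ≡ asc 1 h ++ (A ++ K ∷ K ∷ C) ++ desc 1 (suc h) →
  h < K → y < K → Maybe.All (_≤ y) (head (A ++ K ∷ K ∷ C)) → All (_< K) A → All (_< K) C →
  length H ≡ K + K → ∃ λ x → x ≤ y × CastShape K (asc 1 h) x (desc 1 (suc h)) H
CastShape-at {A = []} _ _ y<K (Maybe.just K≤y) _ _ _ = contradiction K≤y (<⇒≱ y<K)
CastShape-at {h = h} {A = x ∷ D} {C} H≡ h<K y<K (Maybe.just x≤y) (_ ∷ D<K) C<K length-H = x , x≤y , record
  { D = D ; E = C ; H≡ = H≡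
  ; length-S = trans (length-desc 1 (suc h)) (cong suc (sym (length-asc 1 h)))
  ; length-H = length-H
  ; P<K = asc-< 1 h h<K ; x<K = ≤-<-trans x≤y y<K ; D<K = D<K ; E<K = C<K }

-- The invariant of F

record Layout (n K : ℕ) : Set where
  field
    h : ℕ
    A C : List ℕ
    γ≡ : γ n ≡ suc h
    F≡ : F n ≡ asc 1 h ++ (A ++ K ∷ K ∷ C) ++ desc 1 (suc h)
    A<K : All (_< K) A
    C<K : All (_< K) C
    head≤ : Maybe.All (_≤ suc h + δ n) (head (A ++ K ∷ K ∷ C))
    length-F : length (F n) ≡ K + K

record ParentShape (n : ℕ) : Set where
  field
    h x : ℕ
    γ≡ : γ n ≡ suc h
    shape : CastShape (suc (ℓ n)) (asc 1 h) x (desc 1 (suc h)) (blowTo (suc (ℓ n)) (F (ρ n)))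
    x≤ : x ≤ h + δ n

  γ≡length : γ n ≡ suc (length (asc 1 h))
  γ≡length = trans γ≡ (cong suc (sym (length-asc 1 h)))

layout-from-parent : ∀ n → ParentShape (suc n) → Layout (suc n) (suc (ℓ (suc n)))
layout-from-parent n parent = record
  { h = h ; A = A ; C = C ; γ≡ = γ≡
  ; F≡ = F≡
  ; A<K = A<K ; C<K = C<K
  ; head≤ = Maybe.map (λ y≤ → ≤-trans y≤ (s≤s x≤)) head≤
  ; length-F = trans (cong length F≡) (length-Cast-shape shape)
  }
  where
  open ParentShape parent
  open CastOfBlock (castView shape)
  F≡ : F (suc n) ≡ asc 1 h ++ (A ++ _ ∷ _ ∷ C) ++ desc 1 (suc h)
  F≡ = trans (F-suc n) (trans (cong (λ g → Cast g (blowTo (suc (ℓ (suc n))) (F (ρ (suc n))))) γ≡length)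
                              (Cast-shape shape))

blowTo-id : ∀ k H → length H ≡ k + k → blowTo k H ≡ H
blowTo-id k H len = cong (λ i → qIter i H)
  (trans (cong (λ l → k ∸ l / 2) len) (trans (cong (k ∸_) ([n+n]/2≡n k)) (n∸n≡0 k)))

parent-shape-root : ∀ n → ρ (suc n) ≡ 0 → ParentShape (suc n)
parent-shape-root n ρ≡0 = record
  { h = j ; x = suc j ; γ≡ = γ-rightmost n
  ; shape = CastShape-below G≡ j<L ≤-refl j<L ≤-refl [] [] (trans (cong length G≡) (length-pyramid L))
  ; x≤ = m<m+n j (δ-pos n)
  }
  where
  open RightmostNonzero (rightmost n) using (j)
  L : ℕ
  L = ℓ (suc n)
  G≡ : blowTo (suc L) (F (ρ (suc n))) ≡ pyramid L
  G≡ = trans (cong (λ m → blowTo (suc L) (F m)) ρ≡0) (qIter-pyramid L)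
  j<L : j < L
  j<L = ≤-pred (subst (_< suc L) (γ-rightmost n) (γ<ℓ+1 n))

blowTo-parent : ∀ n m → ρ (suc n) ≡ suc m → length (F (suc m)) ≡ suc (ℓ (suc n)) + suc (ℓ (suc n)) →
  blowTo (suc (ℓ (suc n))) (F (ρ (suc n))) ≡ F (suc m)
blowTo-parent n m ρ≡ len =
  trans (cong (λ r → blowTo (suc (ℓ (suc n))) (F r)) ρ≡) (blowTo-id _ (F (suc m)) len)

parent-shape-step : ∀ n m → ρ (suc n) ≡ suc m → Layout (suc m) (suc (ℓ (suc m))) → ParentShape (suc n)
parent-shape-step n m ρ≡ layout with parent-case n m ρ≡
... | ℓ≡ , same-γ γm≡γn δ≡ = record
  { h = h ; x = proj₁ at ; γ≡ = γn≡ ; shape = proj₂ (proj₂ at) ; x≤ = proj₁ (proj₂ at) }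
  where
  open Layout (subst (Layout (suc m)) (cong suc ℓ≡) layout)
  K : ℕ
  K = suc (ℓ (suc n))
  G≡ : blowTo K (F (ρ (suc n))) ≡ F (suc m)
  G≡ = blowTo-parent n m ρ≡ length-F
  γn≡ : γ (suc n) ≡ suc h
  γn≡ = trans (sym γm≡γn) γ≡
  y≡ : suc h + δ (suc m) ≡ h + δ (suc n)
  y≡ = trans (sym (+-suc h (δ (suc m)))) (cong (h +_) (sym δ≡))
  at : ∃ λ x → x ≤ h + δ (suc n) × CastShape K (asc 1 h) x (desc 1 (suc h)) (blowTo K (F (ρ (suc n))))
  at = CastShape-at (trans G≡ F≡)
    (<-trans (n<1+n h) (subst (_< K) γn≡ (γ<ℓ+1 n)))
    (subst (λ g → g + δ (suc n) ≤ K) γn≡ (γ+δ≤ n))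
    (Maybe.map (λ ≤y → ≤-trans ≤y (≤-reflexive y≡)) head≤)
    A<K C<K (trans (cong length G≡) length-F)
... | ℓ≡ , larger-γ γn<γm = record
  { h = j ; x = suc j ; γ≡ = γ-rightmost n
  ; shape = CastShape-below (trans G≡ F≡) j<h h<K (m<n⇒m<1+n j<h) h+1<K A<K C<K
              (trans (cong length G≡) length-F)
  ; x≤ = m<m+n j (δ-pos n)
  }
  where
  open RightmostNonzero (rightmost n) using (j)
  open Layout (subst (Layout (suc m)) (cong suc ℓ≡) layout)
  K : ℕ
  K = suc (ℓ (suc n))
  G≡ : blowTo K (F (ρ (suc n))) ≡ F (suc m)
  G≡ = blowTo-parent n m ρ≡ length-F
  j<h : j < h
  j<h = ≤-pred (subst₂ _<_ (γ-rightmost n) γ≡ γn<γm)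
  h+1<K : suc h < K
  h+1<K = subst₂ (λ g l → g < suc l) γ≡ ℓ≡ (γ<ℓ+1 m)
  h<K : h < K
  h<K = <-trans (n<1+n h) h+1<K

parent-shape : ∀ n → (∀ {m} → m < n → Layout (suc m) (suc (ℓ (suc m)))) → ParentShape (suc n)
parent-shape n layout< with ρ (suc n) in ρ≡
... | zero  = parent-shape-root n ρ≡
... | suc m = parent-shape-step n m ρ≡ (layout< (subst (_≤ n) ρ≡ (ρ-≤ n)))

layout : ∀ n → Layout (suc n) (suc (ℓ (suc n)))
layout = <-rec (λ n → Layout (suc n) (suc (ℓ (suc n))))
               (λ n layout< → layout-from-parent n (parent-shape n layout<))

lemma26 : (n : ℕ) → n ≥ 1 → (i : ℕ) →
    Cast (γ n) (qIter i (blowTo (suc (ℓ n)) (F (ρ n)))) ≡ qIter i (F n)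
lemma26 (suc n) _ i = begin
  Cast (γ (suc n)) (qIter i G)                 ≡⟨ cong (λ g → Cast g (qIter i G)) γ≡length ⟩
  Cast (suc (length (asc 1 h))) (qIter i G)    ≡⟨ Cast-qIter-comm i shape ⟩
  qIter i (Cast (suc (length (asc 1 h))) G)    ≡⟨ cong (λ g → qIter i (Cast g G)) γ≡length ⟨
  qIter i (Cast (γ (suc n)) G)                 ≡⟨ cong (qIter i) (F-suc n) ⟨
  qIter i (F (suc n))                          ∎
  where
  open ParentShape (parent-shape n (λ {m} _ → layout m))
  G : List ℕ
  G = blowTo (suc (ℓ (suc n))) (F (ρ (suc n)))
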